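{- Let $\mathcal E$ be a path object category with its associated cloven weak factorisation system, and let $(x,p)\colon X\to\Gamma$ be a cloven $\mathcal R$-map. Then to each object $V$, each homotopy $\psi\colon c'\Rightarrow c\colon V\to\Gamma$ and each homotopy $\xi\colon y\Rightarrow z\colon V\to X$ constant over $c$, one may associate a homotopy $\psi^*(\xi)\colon\psi^*(y)\Rightarrow\psi^*(z)\colon V\to X$ constant over $c'$, in such a way that $(\psi f)^*(\xi f)=\psi^*(\xi).f$ for all $f\colon W\to V$, and such that $\psi^*(\xi)=\xi$ whenever $\psi$ is an identity homotopy.
   Context: Path object category: finitely complete $\mathcal E$ with (Axiom 1) a pullback-preserving endofunctor $M$ and natural $s,t\colon MX\to X$, $r\colon X\to MX$, $m\colon MX\,{}_{s_X}\!\times_{t_X}MX\to MX$, $\tau$ making $(X,MX,s_X,t_X,r_X,m_X)$ an internal category ($s_Xm_X=s_X\pi_2$, $t_Xm_X=t_X\pi_1$) with $\tau_X$ an involution giving an identity-on-objects isomorphism with its opposite; (Axiom 2) a strength $\alpha_{X,Y}\colon MX\times Y\to M(X\times Y)$ for which $s,t,r,m,\tau$ are strong; (Axiom 3) a strong natural $\eta\colon M\Rightarrow MM$ with $s_{MX}\eta_X=1$, $t_{MX}\eta_X=r_Xt_X$, $Ms_X\eta_X=1$, $Mt_X\eta_X=\alpha_{1,X}(M!,t_X)$, $\eta_Xr_X=r_{MX}r_X$. Associated cloven w.f.s.: for $f\colon X\to Y$, $Pf=X\times_{f,t_Y}MY$, $\rho_f=s_Yd_f$ ($d_f$ the projection to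 $MY$), $\lambda_f=(1_X,r_Yf)$. A cloven $\mathcal R$-map structure on $x$ is $p\colon Px\to X$ with $p\lambda_x=1_X$, $xp=\rho_x$. A homotopy $\theta\colon f\Rightarrow g\colon V\to Y$ is a map $V\to MY$ with $s_Y\theta=f$, $t_Y\theta=g$; identity homotopies are $r_Yf$; $\theta.u=\theta u$. For $w\colon V\to X$ with $xw=c$ and $\psi\colon c'\Rightarrow c$, $\psi^*(w)=p\circ(w,\psi)\colon V\to X$ where $(w,\psi)\colon V\to Px$. A homotopy $\chi\colon V\to MX$ is constant over $b\colon V\to\Gamma$ if $Mx\circ\chi=\alpha_{1,\Gamma}\circ(\ell,b)$ for some $\ell\colon V\to M1$ (in particular $xy=xz=c$ above). -}

module Defs where

open import Level using (Level; _⊔_) renaming (suc to lsuc)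
open import Relation.Binary.PropositionalEquality
open import Data.Product using (Σ; _,_; Σ-syntax) renaming (_×_ to _∧_)

record Category (o ℓ : Level) : Set (lsuc (o ⊔ ℓ)) where
  infixr 9 _∘_
  field
    Obj : Set o
    Hom : Obj → Obj → Set ℓ
    id  : ∀ {A} → Hom A A
    _∘_ : ∀ {A B C} → Hom B C → Hom A B → Hom A C
    identityˡ : ∀ {A B} {f : Hom A B} → id ∘ f ≡ f
    identityʳ : ∀ {A B} {f : Hom A B} → f ∘ id ≡ f
    assoc : ∀ {A B C D} {f : Hom A B} {g : Hom B C} {h : Hom C D} →
            (h ∘ g) ∘ f ≡ h ∘ (g ∘ f)

record FiniteLimits {o ℓ} (C : Category o ℓ) : Set (o ⊔ ℓ) where
  open Category C
  infixr 7 _×_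
  field
    ⊤ : Obj
    ! : ∀ {A} → Hom A ⊤
    !-unique : ∀ {A} (f : Hom A ⊤) → f ≡ !
    _×_ : Obj → Obj → Obj
    π₁ : ∀ {A B} → Hom (A × B) A
    π₂ : ∀ {A B} → Hom (A × B) B
    ⟨_,_⟩ : ∀ {V A B} → Hom V A → Hom V B → Hom V (A × B)
    π₁-β : ∀ {V A B} {f : Hom V A} {g : Hom V B} → π₁ ∘ ⟨ f , g ⟩ ≡ f
    π₂-β : ∀ {V A B} {f : Hom V A} {g : Hom V B} → π₂ ∘ ⟨ f , g ⟩ ≡ g
    ⟨⟩-unique : ∀ {V A B} {f : Hom V A} {g : Hom V B} {h : Hom V (A × B)} →
                π₁ ∘ h ≡ f → π₂ ∘ h ≡ g → h ≡ ⟨ f , g ⟩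
    Pb : ∀ {A B C} → Hom A C → Hom B C → Obj
    pb₁ : ∀ {A B C} {f : Hom A C} {g : Hom B C} → Hom (Pb f g) A
    pb₂ : ∀ {A B C} {f : Hom A C} {g : Hom B C} → Hom (Pb f g) B
    pb-comm : ∀ {A B C} {f : Hom A C} {g : Hom B C} →
              f ∘ pb₁ {f = f} {g = g} ≡ g ∘ pb₂ {f = f} {g = g}
    pb⟨_,_⟩[_] : ∀ {V A B C} {f : Hom A C} {g : Hom B C}
                 (h : Hom V A) (k : Hom V B) → f ∘ h ≡ g ∘ k → Hom V (Pb f g)
    pb₁-β : ∀ {V A B C} {f : Hom A C} {g : Hom B C} {h : Hom V A} {k : Hom V B}
              {e : f ∘ h ≡ g ∘ k} → pb₁ {f = f} {g = g} ∘ pb⟨ h , k ⟩[ e ] ≡ h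
    pb₂-β : ∀ {V A B C} {f : Hom A C} {g : Hom B C} {h : Hom V A} {k : Hom V B}
              {e : f ∘ h ≡ g ∘ k} → pb₂ {f = f} {g = g} ∘ pb⟨ h , k ⟩[ e ] ≡ k
    pb-unique : ∀ {V A B C} {f : Hom A C} {g : Hom B C} {h : Hom V A} {k : Hom V B}
                  {e : f ∘ h ≡ g ∘ k} {u : Hom V (Pb f g)} →
                  pb₁ ∘ u ≡ h → pb₂ ∘ u ≡ k → u ≡ pb⟨ h , k ⟩[ e ]

record Endofunctor {o ℓ} (C : Category o ℓ) : Set (o ⊔ ℓ) where
  open Category C
  field
    F₀ : Obj → Obj
    F₁ : ∀ {A B} → Hom A B → Hom (F₀ A) (F₀ B)
    F-id : ∀ {A} → F₁ (id {A}) ≡ id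
    F-∘ : ∀ {A B D} {f : Hom A B} {g : Hom B D} → F₁ (g ∘ f) ≡ F₁ g ∘ F₁ f

module LimOps {o ℓ} (C : Category o ℓ) (L : FiniteLimits C) where
  open Category C
  open FiniteLimits L
  open ≡-Reasoning

  infixr 8 _×₁_
  _×₁_ : ∀ {A B A' B'} → Hom A A' → Hom B B' → Hom (A × B) (A' × B')
  f ×₁ g = ⟨ f ∘ π₁ , g ∘ π₂ ⟩

  assocˣ : ∀ {A B D} → Hom ((A × B) × D) (A × (B × D))
  assocˣ = ⟨ π₁ ∘ π₁ , ⟨ π₂ ∘ π₁ , π₂ ⟩ ⟩

  ×₁∘⟨⟩ : ∀ {V A B A' B'} {f : Hom A A'} {g : Hom B B'} {h : Hom V A} {k : Hom V B} →
          (f ×₁ g) ∘ ⟨ h , k ⟩ ≡ ⟨ f ∘ h , g ∘ k ⟩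
  ×₁∘⟨⟩ {f = f} {g} {h} {k} = ⟨⟩-unique
    (begin π₁ ∘ ((f ×₁ g) ∘ ⟨ h , k ⟩) ≡⟨ sym assoc ⟩
           (π₁ ∘ (f ×₁ g)) ∘ ⟨ h , k ⟩ ≡⟨ cong (_∘ ⟨ h , k ⟩) π₁-β ⟩
           (f ∘ π₁) ∘ ⟨ h , k ⟩ ≡⟨ assoc ⟩
           f ∘ (π₁ ∘ ⟨ h , k ⟩) ≡⟨ cong (f ∘_) π₁-β ⟩
           f ∘ h ∎)
    (begin π₂ ∘ ((f ×₁ g) ∘ ⟨ h , k ⟩) ≡⟨ sym assoc ⟩
           (π₂ ∘ (f ×₁ g)) ∘ ⟨ h , k ⟩ ≡⟨ cong (_∘ ⟨ h , k ⟩) π₂-β ⟩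
           (g ∘ π₂) ∘ ⟨ h , k ⟩ ≡⟨ assoc ⟩
           g ∘ (π₂ ∘ ⟨ h , k ⟩) ≡⟨ cong (g ∘_) π₂-β ⟩
           g ∘ k ∎)

  ×₁∘×₁ : ∀ {A B A' B' A'' B''} {f : Hom A' A''} {g : Hom B' B''} {h : Hom A A'} {k : Hom B B'} →
          (f ×₁ g) ∘ (h ×₁ k) ≡ (f ∘ h) ×₁ (g ∘ k)
  ×₁∘×₁ {f = f} {g} {h} {k} =
    trans ×₁∘⟨⟩ (cong₂ ⟨_,_⟩ (sym assoc) (sym assoc))

module FunOps {o ℓ} (C : Category o ℓ) (L : FiniteLimits C) (M : Endofunctor C) where
  open Category C
  open FiniteLimits L
  open Endofunctor M

  pbComparison : ∀ {A B D} (f : Hom A D) (g : Hom B D) →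
                 Hom (F₀ (Pb f g)) (Pb (F₁ f) (F₁ g))
  pbComparison f g =
    pb⟨ F₁ pb₁ , F₁ pb₂ ⟩[ trans (sym F-∘) (trans (cong F₁ pb-comm) F-∘) ]

  PreservesPullbacks : Set (o ⊔ ℓ)
  PreservesPullbacks = ∀ {A B D} (f : Hom A D) (g : Hom B D) →
    Σ[ inv ∈ Hom (Pb (F₁ f) (F₁ g)) (F₀ (Pb f g)) ]
      ((inv ∘ pbComparison f g ≡ id) ∧ (pbComparison f g ∘ inv ≡ id))

record PathBase {o ℓ} (C : Category o ℓ) (L : FiniteLimits C) (Mf : Endofunctor C)
       : Set (o ⊔ ℓ) where
  open Category C
  open FiniteLimits L
  open LimOps C L
  open Endofunctor Mf renaming (F₀ to M; F₁ to M₁)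
  field
    s t : ∀ {X} → Hom (M X) X
    r   : ∀ {X} → Hom X (M X)
    τ   : ∀ {X} → Hom (M X) (M X)
    s-nat : ∀ {X Y} {f : Hom X Y} → s ∘ M₁ f ≡ f ∘ s
    t-nat : ∀ {X Y} {f : Hom X Y} → t ∘ M₁ f ≡ f ∘ t
    r-nat : ∀ {X Y} {f : Hom X Y} → r ∘ f ≡ M₁ f ∘ r
    τ-nat : ∀ {X Y} {f : Hom X Y} → τ ∘ M₁ f ≡ M₁ f ∘ τ
    s-r : ∀ {X} → s ∘ r {X} ≡ id
    t-r : ∀ {X} → t ∘ r {X} ≡ id
    τ-τ : ∀ {X} → τ ∘ τ {X} ≡ id
    s-τ : ∀ {X} → s ∘ τ {X} ≡ t
    t-τ : ∀ {X} → t ∘ τ {X} ≡ s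
    τ-r : ∀ {X} → τ ∘ r {X} ≡ r
    α : ∀ {X Y} → Hom (M X × Y) (M (X × Y))
    α-nat : ∀ {X X' Y Y'} {f : Hom X X'} {g : Hom Y Y'} →
            α ∘ (M₁ f ×₁ g) ≡ M₁ (f ×₁ g) ∘ α
    α-unit : ∀ {X} → M₁ π₁ ∘ α {X} {⊤} ≡ π₁
    α-assoc : ∀ {X Y Z} →
      M₁ assocˣ ∘ (α {X × Y} {Z} ∘ (α {X} {Y} ×₁ id)) ≡ α {X} {Y × Z} ∘ assocˣ
    s-strong : ∀ {X Y} → s ∘ α {X} {Y} ≡ s ×₁ id
    t-strong : ∀ {X Y} → t ∘ α {X} {Y} ≡ t ×₁ id
    r-strong : ∀ {X Y} → r {X × Y} ≡ α ∘ (r ×₁ id)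
    τ-strong : ∀ {X Y} → τ ∘ α {X} {Y} ≡ α ∘ (τ ×₁ id)
    η : ∀ {X} → Hom (M X) (M (M X))
    η-nat : ∀ {X Y} {f : Hom X Y} → M₁ (M₁ f) ∘ η ≡ η ∘ M₁ f
    η-strong : ∀ {X Y} → η {X × Y} ∘ α ≡ M₁ α ∘ (α {M X} {Y} ∘ (η ×₁ id))
    s-η : ∀ {X} → s ∘ η {X} ≡ id
    t-η : ∀ {X} → t ∘ η {X} ≡ r ∘ t
    Ms-η : ∀ {X} → M₁ s ∘ η {X} ≡ id
    -- α_{1,X}(M!, t), read through the canonical iso M(1 × X) ≅ M X
    Mt-η : ∀ {X} → M₁ t ∘ η {X} ≡ M₁ π₂ ∘ (α {⊤} {X} ∘ ⟨ M₁ ! , t ⟩)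
    η-r : ∀ {X} → η ∘ r {X} ≡ r ∘ r

module BaseOps {o ℓ} (C : Category o ℓ) (L : FiniteLimits C) (Mf : Endofunctor C)
               (B : PathBase C L Mf) where
  open Category C
  open FiniteLimits L
  open LimOps C L
  open Endofunctor Mf renaming (F₀ to M; F₁ to M₁)
  open PathBase B
  open ≡-Reasoning

  Comp : Obj → Obj
  Comp X = Pb (s {X}) (t {X})

  Comp-map : ∀ {X Y} (f : Hom X Y) → Hom (Comp X) (Comp Y)
  Comp-map f = pb⟨ M₁ f ∘ pb₁ , M₁ f ∘ pb₂ ⟩[ e ]
    where
    e = begin s ∘ (M₁ f ∘ pb₁) ≡⟨ sym assoc ⟩
              (s ∘ M₁ f) ∘ pb₁ ≡⟨ cong (_∘ pb₁) s-nat ⟩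
              (f ∘ s) ∘ pb₁ ≡⟨ assoc ⟩
              f ∘ (s ∘ pb₁) ≡⟨ cong (f ∘_) pb-comm ⟩
              f ∘ (t ∘ pb₂) ≡⟨ sym assoc ⟩
              (f ∘ t) ∘ pb₂ ≡⟨ cong (_∘ pb₂) (sym t-nat) ⟩
              (t ∘ M₁ f) ∘ pb₂ ≡⟨ assoc ⟩
              t ∘ (M₁ f ∘ pb₂) ∎

  unitL-eq : ∀ {X} → s ∘ (r ∘ t) ≡ t ∘ id {M X}
  unitL-eq = trans (sym assoc) (trans (cong (_∘ t) s-r) (trans identityˡ (sym identityʳ)))

  unitR-eq : ∀ {X} → s ∘ id {M X} ≡ t ∘ (r ∘ s)
  unitR-eq = trans identityʳ (sym (trans (sym assoc) (trans (cong (_∘ s) t-r) identityˡ)))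

  swap-eq : ∀ {X} → s ∘ (τ ∘ pb₂ {f = s {X}} {g = t {X}}) ≡ t ∘ (τ ∘ pb₁ {f = s {X}} {g = t {X}})
  swap-eq = begin s ∘ (τ ∘ pb₂) ≡⟨ sym assoc ⟩ (s ∘ τ) ∘ pb₂ ≡⟨ cong (_∘ pb₂) s-τ ⟩
                  t ∘ pb₂ ≡⟨ sym pb-comm ⟩ s ∘ pb₁ ≡⟨ cong (_∘ pb₁) (sym t-τ) ⟩
                  (t ∘ τ) ∘ pb₁ ≡⟨ assoc ⟩ t ∘ (τ ∘ pb₁) ∎

  strong-eq : ∀ {X Y} →
    s ∘ (α ∘ (pb₁ {f = s {X}} {g = t {X}} ×₁ id {Y})) ≡ t ∘ (α ∘ (pb₂ {f = s {X}} {g = t {X}} ×₁ id {Y}))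
  strong-eq = begin
    s ∘ (α ∘ (pb₁ ×₁ id)) ≡⟨ sym assoc ⟩
    (s ∘ α) ∘ (pb₁ ×₁ id) ≡⟨ cong (_∘ (pb₁ ×₁ id)) s-strong ⟩
    (s ×₁ id) ∘ (pb₁ ×₁ id) ≡⟨ ×₁∘×₁ ⟩
    (s ∘ pb₁) ×₁ (id ∘ id) ≡⟨ cong (_×₁ (id ∘ id)) pb-comm ⟩
    (t ∘ pb₂) ×₁ (id ∘ id) ≡⟨ sym ×₁∘×₁ ⟩
    (t ×₁ id) ∘ (pb₂ ×₁ id) ≡⟨ cong (_∘ (pb₂ ×₁ id)) (sym t-strong) ⟩
    (t ∘ α) ∘ (pb₂ ×₁ id) ≡⟨ assoc ⟩
    t ∘ (α ∘ (pb₂ ×₁ id)) ∎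

record PathComp {o ℓ} (C : Category o ℓ) (L : FiniteLimits C) (Mf : Endofunctor C)
       (B : PathBase C L Mf) : Set (o ⊔ ℓ) where
  open Category C
  open FiniteLimits L
  open LimOps C L
  open Endofunctor Mf renaming (F₀ to M; F₁ to M₁)
  open PathBase B
  open BaseOps C L Mf B
  field
    m : ∀ {X} → Hom (Comp X) (M X)
    m-nat : ∀ {X Y} {f : Hom X Y} → M₁ f ∘ m ≡ m ∘ Comp-map f
    s-m : ∀ {X} → s ∘ m {X} ≡ s ∘ pb₂
    t-m : ∀ {X} → t ∘ m {X} ≡ t ∘ pb₁
    m-unitˡ : ∀ {X} → m ∘ pb⟨ r ∘ t , id ⟩[ unitL-eq {X} ] ≡ id
    m-unitʳ : ∀ {X} → m ∘ pb⟨ id , r ∘ s ⟩[ unitR-eq {X} ] ≡ id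
    -- associativity, stated on generalised elements a, b, c : V → MX
    m-assoc : ∀ {V X} {a b c : Hom V (M X)} (e₁ : s ∘ a ≡ t ∘ b) (e₂ : s ∘ b ≡ t ∘ c) →
      m ∘ pb⟨ m ∘ pb⟨ a , b ⟩[ e₁ ] , c ⟩[
              trans (sym assoc) (trans (cong (_∘ pb⟨ a , b ⟩[ e₁ ]) s-m)
                (trans assoc (trans (cong (s ∘_) pb₂-β) e₂))) ]
      ≡ m ∘ pb⟨ a , m ∘ pb⟨ b , c ⟩[ e₂ ] ⟩[
              trans e₁ (sym (trans (sym assoc) (trans (cong (_∘ pb⟨ b , c ⟩[ e₂ ]) t-m)
                (trans assoc (cong (t ∘_) pb₁-β))))) ]
    τ-m : ∀ {X} → τ ∘ m {X} ≡ m ∘ pb⟨ τ ∘ pb₂ , τ ∘ pb₁ ⟩[ swap-eq ]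
    m-strong : ∀ {X Y} →
      m {X × Y} ∘ pb⟨ α ∘ (pb₁ ×₁ id) , α ∘ (pb₂ ×₁ id) ⟩[ strong-eq {X} {Y} ]
      ≡ α ∘ (m ×₁ id)

record PathObjectCategory (o ℓ : Level) : Set (lsuc (o ⊔ ℓ)) where
  field
    cat : Category o ℓ
    lim : FiniteLimits cat
    Mfun : Endofunctor cat
    M-pullbacks : FunOps.PreservesPullbacks cat lim Mfun
    base : PathBase cat lim Mfun
    comp : PathComp cat lim Mfun base

module PathOps {o ℓ} (E : PathObjectCategory o ℓ) where
  open PathObjectCategory E
  open Category cat public
  open FiniteLimits lim public
  open LimOps cat lim public
  open Endofunctor Mfun public renaming (F₀ to M; F₁ to M₁)
  open PathBase base public
  open PathComp comp public
  open ≡-Reasoning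

  P : ∀ {X Y} → Hom X Y → Obj
  P {Y = Y} f = Pb f (t {Y})

  ρ : ∀ {X Y} (f : Hom X Y) → Hom (P f) Y
  ρ f = s ∘ pb₂ {f = f} {g = t}

  λ-eq : ∀ {X Y} (f : Hom X Y) → f ∘ id ≡ t ∘ (r ∘ f)
  λ-eq f = trans identityʳ (sym (trans (sym assoc) (trans (cong (_∘ f) t-r) identityˡ)))

  λ' : ∀ {X Y} (f : Hom X Y) → Hom X (P f)
  λ' f = pb⟨ id , r ∘ f ⟩[ λ-eq f ]

  record RMap {X Γ : Obj} (x : Hom X Γ) : Set ℓ where
    field
      p : Hom (P x) X
      p-λ : p ∘ λ' x ≡ id
      x-p : x ∘ p ≡ ρ x

  IsHomotopy : ∀ {V Y} (θ : Hom V (M Y)) (f g : Hom V Y) → Set ℓ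
  IsHomotopy θ f g = (s ∘ θ ≡ f) ∧ (t ∘ θ ≡ g)

  transport : ∀ {V X Γ} {x : Hom X Γ} (R : RMap x) (w : Hom V X) (ψ : Hom V (M Γ)) →
              x ∘ w ≡ t ∘ ψ → Hom V X
  transport R w ψ e = RMap.p R ∘ pb⟨ w , ψ ⟩[ e ]

  -- χ : V → MX is constant over b : V → Γ (w.r.t. x); α_{1,Γ} read through M(1×Γ) ≅ MΓ
  IsConstOver : ∀ {V X Γ} (x : Hom X Γ) (χ : Hom V (M X)) (b : Hom V Γ) → Set ℓ
  IsConstOver {V} x χ b =
    Σ[ l ∈ Hom V (M ⊤) ] (M₁ x ∘ χ ≡ M₁ π₂ ∘ (α ∘ ⟨ l , b ⟩))

  private
    endpoint : ∀ {V X Γ} {x : Hom X Γ} {χ : Hom V (M X)} {b : Hom V Γ}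
      (u : ∀ {Z} → Hom (M Z) Z) →
      (∀ {Z W} {f : Hom Z W} → u ∘ M₁ f ≡ f ∘ u) →
      (∀ {Z W} → u ∘ α {Z} {W} ≡ u ×₁ id) →
      IsConstOver x χ b → x ∘ (u ∘ χ) ≡ b
    endpoint {x = x} {χ} {b} u u-nat u-str (l , K) = begin
      x ∘ (u ∘ χ) ≡⟨ sym assoc ⟩
      (x ∘ u) ∘ χ ≡⟨ cong (_∘ χ) (sym u-nat) ⟩
      (u ∘ M₁ x) ∘ χ ≡⟨ assoc ⟩
      u ∘ (M₁ x ∘ χ) ≡⟨ cong (u ∘_) K ⟩
      u ∘ (M₁ π₂ ∘ (α ∘ ⟨ l , b ⟩)) ≡⟨ sym assoc ⟩
      (u ∘ M₁ π₂) ∘ (α ∘ ⟨ l , b ⟩) ≡⟨ cong (_∘ (α ∘ ⟨ l , b ⟩)) u-nat ⟩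
      (π₂ ∘ u) ∘ (α ∘ ⟨ l , b ⟩) ≡⟨ assoc ⟩
      π₂ ∘ (u ∘ (α ∘ ⟨ l , b ⟩)) ≡⟨ cong (π₂ ∘_) (sym assoc) ⟩
      π₂ ∘ ((u ∘ α) ∘ ⟨ l , b ⟩) ≡⟨ cong (λ z → π₂ ∘ (z ∘ ⟨ l , b ⟩)) u-str ⟩
      π₂ ∘ ((u ×₁ id) ∘ ⟨ l , b ⟩) ≡⟨ cong (π₂ ∘_) ×₁∘⟨⟩ ⟩
      π₂ ∘ ⟨ u ∘ l , id ∘ b ⟩ ≡⟨ π₂-β ⟩
      id ∘ b ≡⟨ identityˡ ⟩
      b ∎

  const-src : ∀ {V X Γ} {x : Hom X Γ} {χ : Hom V (M X)} {b : Hom V Γ} →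
              IsConstOver x χ b → x ∘ (s ∘ χ) ≡ b
  const-src = endpoint s s-nat s-strong

  const-tgt : ∀ {V X Γ} {x : Hom X Γ} {χ : Hom V (M X)} {b : Hom V Γ} →
              IsConstOver x χ b → x ∘ (t ∘ χ) ≡ b
  const-tgt = endpoint t t-nat t-strong

  -- Data of Lemma 6.9: an assignment (ψ , ξ) ↦ ψ*(ξ) for ψ : c' ⇒ c (c' = sψ, c = tψ)
  -- and ξ : y ⇒ z (y = sξ, z = tξ) constant over c.
  LiftOp : ∀ {X Γ} (x : Hom X Γ) → Set (o ⊔ ℓ)
  LiftOp {X} {Γ} x = ∀ {V} (ψ : Hom V (M Γ)) (ξ : Hom V (M X)) →
                     IsConstOver x ξ (t ∘ ψ) → Hom V (M X)

  record IsHomotopyLift {X Γ} {x : Hom X Γ} (R : RMap x) (F : LiftOp x) : Set (o ⊔ ℓ) where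
    field
      lift-homotopy : ∀ {V} (ψ : Hom V (M Γ)) (ξ : Hom V (M X))
        (K : IsConstOver x ξ (t ∘ ψ)) →
        IsHomotopy (F ψ ξ K) (transport R (s ∘ ξ) ψ (const-src K))
                             (transport R (t ∘ ξ) ψ (const-tgt K))
      lift-const : ∀ {V} (ψ : Hom V (M Γ)) (ξ : Hom V (M X))
        (K : IsConstOver x ξ (t ∘ ψ)) → IsConstOver x (F ψ ξ K) (s ∘ ψ)
      lift-natural : ∀ {V W} (f : Hom W V) (ψ : Hom V (M Γ)) (ξ : Hom V (M X))
        (K : IsConstOver x ξ (t ∘ ψ)) (K' : IsConstOver x (ξ ∘ f) (t ∘ (ψ ∘ f))) →
        F (ψ ∘ f) (ξ ∘ f) K' ≡ F ψ ξ K ∘ f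
      lift-identity : ∀ {V} (c : Hom V Γ) (ξ : Hom V (M X))
        (K : IsConstOver x ξ (t ∘ (r ∘ c))) → F (r ∘ c) ξ K ≡ ξ

module Submission where

-- A homotopy ψ : c' ⇒ c in Γ is itself a point of MΓ, so it has a
-- constant path  κ(ℓ , ψ) = Mπ₂ ∘ α ∘ ⟨ ℓ , ψ ⟩ : V → M(MΓ)  at any "level"
-- ℓ : V → M1.  If ξ : V → MX is constant over c = tψ with level ℓ = M! ∘ ξ,
-- then Mx ∘ ξ = Mt ∘ κ(ℓ , ψ), and since M preserves the pullback
-- Px = X ×_Γ MΓ the pair (ξ , κ(ℓ , ψ)) is a map V → M(Px).  Applying Mp gives
-- ψ*(ξ) : V → MX, i.e. ψ*(ξ) is M(transport) applied to the pair.

open import Defs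
open import Data.Product using (Σ; Σ-syntax; _,_; proj₁; proj₂)
open import Level using (_⊔_)
open import Relation.Binary.PropositionalEquality

module HomotopyLifting {o ℓ} (E : PathObjectCategory o ℓ) where
  open PathOps E
  open PathObjectCategory E using (cat; lim; Mfun; M-pullbacks)
  open FunOps cat lim Mfun using (pbComparison)
  open ≡-Reasoning

  ⟨⟩∘ : ∀ {W V A B} {a : Hom V A} {b : Hom V B} {f : Hom W V} →
        ⟨ a , b ⟩ ∘ f ≡ ⟨ a ∘ f , b ∘ f ⟩
  ⟨⟩∘ {f = f} = ⟨⟩-unique (trans (sym assoc) (cong (_∘ f) π₁-β))
                           (trans (sym assoc) (cong (_∘ f) π₂-β))

  M-fuse : ∀ {V A B D} {g : Hom B D} {h : Hom A B} {w : Hom V (M A)} →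
           M₁ g ∘ (M₁ h ∘ w) ≡ M₁ (g ∘ h) ∘ w
  M-fuse {w = w} = trans (sym assoc) (cong (_∘ w) (sym F-∘))

  !-irrelevant : ∀ {A} (f g : Hom A ⊤) → f ≡ g
  !-irrelevant f g = trans (!-unique f) (sym (!-unique g))

  -- The endpoint maps s, t are natural and strong; these are the only
  -- properties of them used when computing endpoints of paths.
  Natural : (∀ {Z} → Hom (M Z) Z) → Set (o ⊔ ℓ)
  Natural u = ∀ {Z W} {f : Hom Z W} → u ∘ M₁ f ≡ f ∘ u

  Strong : (∀ {Z} → Hom (M Z) Z) → Set (o ⊔ ℓ)
  Strong u = ∀ {Z W} → u ∘ α {Z} {W} ≡ u ×₁ id

  constPath : ∀ {V Y} → Hom V (M ⊤) → Hom V Y → Hom V (M Y)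
  constPath l b = M₁ π₂ ∘ (α ∘ ⟨ l , b ⟩)

  constPath-end : (u : ∀ {Z} → Hom (M Z) Z) → Natural u → Strong u →
                  ∀ {V Y} (l : Hom V (M ⊤)) (b : Hom V Y) → u ∘ constPath l b ≡ b
  constPath-end u u-nat u-str l b = begin
    u ∘ (M₁ π₂ ∘ (α ∘ ⟨ l , b ⟩))   ≡⟨ sym assoc ⟩
    (u ∘ M₁ π₂) ∘ (α ∘ ⟨ l , b ⟩)   ≡⟨ cong (_∘ (α ∘ ⟨ l , b ⟩)) u-nat ⟩
    (π₂ ∘ u) ∘ (α ∘ ⟨ l , b ⟩)      ≡⟨ trans assoc (cong (π₂ ∘_) (sym assoc)) ⟩
    π₂ ∘ ((u ∘ α) ∘ ⟨ l , b ⟩)      ≡⟨ cong (λ z → π₂ ∘ (z ∘ ⟨ l , b ⟩)) u-str ⟩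
    π₂ ∘ ((u ×₁ id) ∘ ⟨ l , b ⟩)    ≡⟨ cong (π₂ ∘_) ×₁∘⟨⟩ ⟩
    π₂ ∘ ⟨ u ∘ l , id ∘ b ⟩         ≡⟨ trans π₂-β identityˡ ⟩
    b ∎

  α-second : ∀ {V A B B'} (u : Hom B B') (l : Hom V (M A)) (b : Hom V B) →
             M₁ (id ×₁ u) ∘ (α ∘ ⟨ l , b ⟩) ≡ α ∘ ⟨ l , u ∘ b ⟩
  α-second u l b = begin
    M₁ (id ×₁ u) ∘ (α ∘ ⟨ l , b ⟩)   ≡⟨ sym assoc ⟩
    (M₁ (id ×₁ u) ∘ α) ∘ ⟨ l , b ⟩   ≡⟨ cong (_∘ ⟨ l , b ⟩) (sym α-nat) ⟩
    (α ∘ (M₁ id ×₁ u)) ∘ ⟨ l , b ⟩   ≡⟨ trans assoc (cong (α ∘_) ×₁∘⟨⟩) ⟩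
    α ∘ ⟨ M₁ id ∘ l , u ∘ b ⟩        ≡⟨ cong (λ z → α ∘ ⟨ z ∘ l , u ∘ b ⟩) F-id ⟩
    α ∘ ⟨ id ∘ l , u ∘ b ⟩           ≡⟨ cong (λ z → α ∘ ⟨ z , u ∘ b ⟩) identityˡ ⟩
    α ∘ ⟨ l , u ∘ b ⟩ ∎

  constPath-map : ∀ {V Y Z} (u : Hom Y Z) (l : Hom V (M ⊤)) (b : Hom V Y) →
                  M₁ u ∘ constPath l b ≡ constPath l (u ∘ b)
  constPath-map u l b = begin
    M₁ u ∘ (M₁ π₂ ∘ (α ∘ ⟨ l , b ⟩))            ≡⟨ M-fuse ⟩
    M₁ (u ∘ π₂) ∘ (α ∘ ⟨ l , b ⟩)               ≡⟨ cong (λ z → M₁ z ∘ (α ∘ ⟨ l , b ⟩)) (sym π₂-β) ⟩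
    M₁ (π₂ ∘ (id ×₁ u)) ∘ (α ∘ ⟨ l , b ⟩)        ≡⟨ sym M-fuse ⟩
    M₁ π₂ ∘ (M₁ (id ×₁ u) ∘ (α ∘ ⟨ l , b ⟩))     ≡⟨ cong (M₁ π₂ ∘_) (α-second u l b) ⟩
    constPath l (u ∘ b) ∎

  constPath-level : ∀ {V Y} (l : Hom V (M ⊤)) (b : Hom V Y) → M₁ ! ∘ constPath l b ≡ l
  constPath-level l b = begin
    M₁ ! ∘ (M₁ π₂ ∘ (α ∘ ⟨ l , b ⟩))            ≡⟨ M-fuse ⟩
    M₁ (! ∘ π₂) ∘ (α ∘ ⟨ l , b ⟩)               ≡⟨ cong (λ z → M₁ z ∘ (α ∘ ⟨ l , b ⟩)) (!-irrelevant _ _) ⟩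
    M₁ (π₁ ∘ (id ×₁ !)) ∘ (α ∘ ⟨ l , b ⟩)        ≡⟨ sym M-fuse ⟩
    M₁ π₁ ∘ (M₁ (id ×₁ !) ∘ (α ∘ ⟨ l , b ⟩))     ≡⟨ cong (M₁ π₁ ∘_) (α-second ! l b) ⟩
    M₁ π₁ ∘ (α ∘ ⟨ l , ! ∘ b ⟩)                  ≡⟨ sym assoc ⟩
    (M₁ π₁ ∘ α) ∘ ⟨ l , ! ∘ b ⟩                  ≡⟨ cong (_∘ ⟨ l , ! ∘ b ⟩) α-unit ⟩
    π₁ ∘ ⟨ l , ! ∘ b ⟩                           ≡⟨ π₁-β ⟩
    l ∎

  constPath-∘ : ∀ {W V Y} (l : Hom V (M ⊤)) (b : Hom V Y) (f : Hom W V) →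
                constPath l b ∘ f ≡ constPath (l ∘ f) (b ∘ f)
  constPath-∘ l b f = begin
    (M₁ π₂ ∘ (α ∘ ⟨ l , b ⟩)) ∘ f   ≡⟨ trans assoc (cong (M₁ π₂ ∘_) assoc) ⟩
    M₁ π₂ ∘ (α ∘ (⟨ l , b ⟩ ∘ f))   ≡⟨ cong (λ z → M₁ π₂ ∘ (α ∘ z)) ⟨⟩∘ ⟩
    constPath (l ∘ f) (b ∘ f) ∎

  canonical-level : ∀ {V X Γ} {x : Hom X Γ} {χ : Hom V (M X)} {b : Hom V Γ} →
                    IsConstOver x χ b → M₁ x ∘ χ ≡ constPath (M₁ ! ∘ χ) b
  canonical-level {x = x} {χ} {b} (l , const) =
    trans const (cong (λ z → constPath z b) (sym level))
    where
    level : M₁ ! ∘ χ ≡ l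
    level = begin
      M₁ ! ∘ χ            ≡⟨ cong (λ z → M₁ z ∘ χ) (!-irrelevant ! (! ∘ x)) ⟩
      M₁ (! ∘ x) ∘ χ      ≡⟨ sym M-fuse ⟩
      M₁ ! ∘ (M₁ x ∘ χ)   ≡⟨ cong (M₁ ! ∘_) const ⟩
      M₁ ! ∘ constPath l b ≡⟨ constPath-level l b ⟩
      l ∎

  -- (2) Pairing into M of a pullback.  Since M preserves the pullback
  -- A ×_D B, maps V → M(A ×_D B) correspond to pairs a : V → MA,
  -- b : V → MB with Mf ∘ a = Mg ∘ b.

  module MPairing {A B D} (f : Hom A D) (g : Hom B D) where

    private
      cmp : Hom (M (Pb f g)) (Pb (M₁ f) (M₁ g))
      cmp = pbComparison f g

      inv : Hom (Pb (M₁ f) (M₁ g)) (M (Pb f g))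
      inv = proj₁ (M-pullbacks f g)

      inv-cmp : inv ∘ cmp ≡ id
      inv-cmp = proj₁ (proj₂ (M-pullbacks f g))

      cmp-inv : cmp ∘ inv ≡ id
      cmp-inv = proj₂ (proj₂ (M-pullbacks f g))

      through-inv : ∀ {V Z} (k : Hom (Pb (M₁ f) (M₁ g)) Z) (j : Hom (M (Pb f g)) Z) →
                    k ∘ cmp ≡ j → (q : Hom V (Pb (M₁ f) (M₁ g))) → j ∘ (inv ∘ q) ≡ k ∘ q
      through-inv k j kc q = begin
        j ∘ (inv ∘ q)           ≡⟨ cong (_∘ (inv ∘ q)) (sym kc) ⟩
        (k ∘ cmp) ∘ (inv ∘ q)   ≡⟨ trans assoc (cong (k ∘_) (sym assoc)) ⟩
        k ∘ ((cmp ∘ inv) ∘ q)   ≡⟨ cong (λ z → k ∘ (z ∘ q)) cmp-inv ⟩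
        k ∘ (id ∘ q)            ≡⟨ cong (k ∘_) identityˡ ⟩
        k ∘ q ∎

    M-pair : ∀ {V} (a : Hom V (M A)) (b : Hom V (M B)) → M₁ f ∘ a ≡ M₁ g ∘ b →
             Hom V (M (Pb f g))
    M-pair a b e = inv ∘ pb⟨ a , b ⟩[ e ]

    M-pair-β₁ : ∀ {V} {a : Hom V (M A)} {b : Hom V (M B)} (e : M₁ f ∘ a ≡ M₁ g ∘ b) →
                M₁ pb₁ ∘ M-pair a b e ≡ a
    M-pair-β₁ e = trans (through-inv pb₁ (M₁ pb₁) pb₁-β _) pb₁-β

    M-pair-β₂ : ∀ {V} {a : Hom V (M A)} {b : Hom V (M B)} (e : M₁ f ∘ a ≡ M₁ g ∘ b) →
                M₁ pb₂ ∘ M-pair a b e ≡ b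
    M-pair-β₂ e = trans (through-inv pb₂ (M₁ pb₂) pb₂-β _) pb₂-β

    M-pair-unique : ∀ {V} {a : Hom V (M A)} {b : Hom V (M B)} (e : M₁ f ∘ a ≡ M₁ g ∘ b)
                    {w : Hom V (M (Pb f g))} → M₁ pb₁ ∘ w ≡ a → M₁ pb₂ ∘ w ≡ b →
                    w ≡ M-pair a b e
    M-pair-unique {V} e {w} w₁ w₂ = begin
      w                   ≡⟨ sym identityˡ ⟩
      id ∘ w              ≡⟨ cong (_∘ w) (sym inv-cmp) ⟩
      (inv ∘ cmp) ∘ w     ≡⟨ assoc ⟩
      inv ∘ (cmp ∘ w)     ≡⟨ cong (inv ∘_) (pb-unique (projection pb₁-β w₁)
                                                     (projection pb₂-β w₂)) ⟩
      M-pair _ _ e ∎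
      where
      projection : ∀ {Z} {k : Hom (Pb (M₁ f) (M₁ g)) Z} {j : Hom (M (Pb f g)) Z} {c : Hom V Z} →
                   k ∘ cmp ≡ j → j ∘ w ≡ c → k ∘ (cmp ∘ w) ≡ c
      projection kc jw = trans (sym assoc) (trans (cong (_∘ w) kc) jw)

    M-pair-∘ : ∀ {W V} {a : Hom V (M A)} {b : Hom V (M B)} (e : M₁ f ∘ a ≡ M₁ g ∘ b)
               (h : Hom W V) {a' : Hom W (M A)} {b' : Hom W (M B)} (e' : M₁ f ∘ a' ≡ M₁ g ∘ b') →
               a ∘ h ≡ a' → b ∘ h ≡ b' → M-pair a' b' e' ≡ M-pair a b e ∘ h
    M-pair-∘ e h e' ah bh = sym (M-pair-unique e'
      (trans (sym assoc) (trans (cong (_∘ h) (M-pair-β₁ e)) ah))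
      (trans (sym assoc) (trans (cong (_∘ h) (M-pair-β₂ e)) bh)))

    M-pair-end : (u : ∀ {Z} → Hom (M Z) Z) → Natural u →
                 ∀ {V} {a : Hom V (M A)} {b : Hom V (M B)} (e : M₁ f ∘ a ≡ M₁ g ∘ b)
                 (e' : f ∘ (u ∘ a) ≡ g ∘ (u ∘ b)) →
                 u ∘ M-pair a b e ≡ pb⟨ u ∘ a , u ∘ b ⟩[ e' ]
    M-pair-end u u-nat e e' = pb-unique (endpoint (M-pair-β₁ e)) (endpoint (M-pair-β₂ e))
      where
      endpoint : ∀ {V Z} {k : Hom (Pb f g) Z} {w : Hom V (M (Pb f g))} {c : Hom V (M Z)} →
                 M₁ k ∘ w ≡ c → k ∘ (u ∘ w) ≡ u ∘ c
      endpoint {k = k} {w} kw = begin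
        k ∘ (u ∘ w)     ≡⟨ sym assoc ⟩
        (k ∘ u) ∘ w     ≡⟨ cong (_∘ w) (sym u-nat) ⟩
        (u ∘ M₁ k) ∘ w  ≡⟨ trans assoc (cong (u ∘_) kw) ⟩
        u ∘ _ ∎

  module Lift {X Γ : Obj} (x : Hom X Γ) (R : RMap x) where
    open RMap R
    open MPairing x (t {Γ})

    lift₂ : ∀ {V} (ψ : Hom V (M Γ)) (ξ : Hom V (M X)) → Hom V (M (M Γ))
    lift₂ ψ ξ = constPath (M₁ ! ∘ ξ) ψ

    lift-agrees : ∀ {V} (ψ : Hom V (M Γ)) (ξ : Hom V (M X)) →
                  IsConstOver x ξ (t ∘ ψ) → M₁ x ∘ ξ ≡ M₁ t ∘ lift₂ ψ ξ
    lift-agrees ψ ξ K = trans (canonical-level K) (sym (constPath-map t (M₁ ! ∘ ξ) ψ))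

    liftPath : ∀ {V} (ψ : Hom V (M Γ)) (ξ : Hom V (M X)) →
               IsConstOver x ξ (t ∘ ψ) → Hom V (M (P x))
    liftPath ψ ξ K = M-pair ξ (lift₂ ψ ξ) (lift-agrees ψ ξ K)

    lift : LiftOp x
    lift ψ ξ K = M₁ p ∘ liftPath ψ ξ K

    lift-end : (u : ∀ {Z} → Hom (M Z) Z) → Natural u → Strong u →
               ∀ {V} (ψ : Hom V (M Γ)) (ξ : Hom V (M X)) (K : IsConstOver x ξ (t ∘ ψ))
               (e : x ∘ (u ∘ ξ) ≡ t ∘ ψ) →
               u ∘ lift ψ ξ K ≡ transport R (u ∘ ξ) ψ e
    lift-end u u-nat u-str ψ ξ K e = begin
      u ∘ (M₁ p ∘ liftPath ψ ξ K)   ≡⟨ sym assoc ⟩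
      (u ∘ M₁ p) ∘ liftPath ψ ξ K   ≡⟨ cong (_∘ liftPath ψ ξ K) u-nat ⟩
      (p ∘ u) ∘ liftPath ψ ξ K      ≡⟨ assoc ⟩
      p ∘ (u ∘ liftPath ψ ξ K)      ≡⟨ cong (p ∘_) (M-pair-end u u-nat _ e') ⟩
      p ∘ pb⟨ u ∘ ξ , u ∘ lift₂ ψ ξ ⟩[ e' ]
        ≡⟨ cong (p ∘_) (pb-unique pb₁-β (trans pb₂-β (constPath-end u u-nat u-str _ ψ))) ⟩
      transport R (u ∘ ξ) ψ e ∎
      where
      e' : x ∘ (u ∘ ξ) ≡ t ∘ (u ∘ lift₂ ψ ξ)
      e' = trans e (cong (t ∘_) (sym (constPath-end u u-nat u-str _ ψ)))

    -- ψ*(ξ) is constant over c' = sψ, with the same level as ξ (uses x p = s d).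
    lift-const : ∀ {V} (ψ : Hom V (M Γ)) (ξ : Hom V (M X)) (K : IsConstOver x ξ (t ∘ ψ)) →
                 IsConstOver x (lift ψ ξ K) (s ∘ ψ)
    lift-const ψ ξ K = M₁ ! ∘ ξ , (begin
      M₁ x ∘ (M₁ p ∘ liftPath ψ ξ K)      ≡⟨ M-fuse ⟩
      M₁ (x ∘ p) ∘ liftPath ψ ξ K         ≡⟨ cong (λ z → M₁ z ∘ liftPath ψ ξ K) x-p ⟩
      M₁ (s ∘ pb₂) ∘ liftPath ψ ξ K       ≡⟨ sym M-fuse ⟩
      M₁ s ∘ (M₁ pb₂ ∘ liftPath ψ ξ K)    ≡⟨ cong (M₁ s ∘_) (M-pair-β₂ _) ⟩
      M₁ s ∘ lift₂ ψ ξ                    ≡⟨ constPath-map s _ ψ ⟩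
      constPath (M₁ ! ∘ ξ) (s ∘ ψ) ∎)

    lift-natural : ∀ {V W} (f : Hom W V) (ψ : Hom V (M Γ)) (ξ : Hom V (M X))
                   (K : IsConstOver x ξ (t ∘ ψ)) (K' : IsConstOver x (ξ ∘ f) (t ∘ (ψ ∘ f))) →
                   lift (ψ ∘ f) (ξ ∘ f) K' ≡ lift ψ ξ K ∘ f
    lift-natural f ψ ξ K K' = begin
      M₁ p ∘ liftPath (ψ ∘ f) (ξ ∘ f) K'   ≡⟨ cong (M₁ p ∘_) (M-pair-∘ _ f _ refl lift₂-∘) ⟩
      M₁ p ∘ (liftPath ψ ξ K ∘ f)          ≡⟨ sym assoc ⟩
      lift ψ ξ K ∘ f ∎
      where
      lift₂-∘ : lift₂ ψ ξ ∘ f ≡ lift₂ (ψ ∘ f) (ξ ∘ f)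
      lift₂-∘ = trans (constPath-∘ _ ψ f) (cong (λ z → constPath z (ψ ∘ f)) assoc)

    -- Over an identity homotopy r c the pairing is M(λx) ∘ ξ, so p ∘ λx = 1
    -- gives ψ*(ξ) = ξ.
    liftPath-identity : ∀ {V} (c : Hom V Γ) (ξ : Hom V (M X))
                        (K : IsConstOver x ξ (t ∘ (r ∘ c))) →
                        M₁ (λ' x) ∘ ξ ≡ liftPath (r ∘ c) ξ K
    liftPath-identity c ξ K = M-pair-unique _ first second
      where
      first : M₁ pb₁ ∘ (M₁ (λ' x) ∘ ξ) ≡ ξ
      first = begin
        M₁ pb₁ ∘ (M₁ (λ' x) ∘ ξ)   ≡⟨ M-fuse ⟩
        M₁ (pb₁ ∘ λ' x) ∘ ξ        ≡⟨ cong (λ z → M₁ z ∘ ξ) pb₁-β ⟩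
        M₁ id ∘ ξ                  ≡⟨ trans (cong (_∘ ξ) F-id) identityˡ ⟩
        ξ ∎
      t-r-c : t ∘ (r ∘ c) ≡ c
      t-r-c = trans (sym assoc) (trans (cong (_∘ c) t-r) identityˡ)
      second : M₁ pb₂ ∘ (M₁ (λ' x) ∘ ξ) ≡ lift₂ (r ∘ c) ξ
      second = begin
        M₁ pb₂ ∘ (M₁ (λ' x) ∘ ξ)                     ≡⟨ M-fuse ⟩
        M₁ (pb₂ ∘ λ' x) ∘ ξ                          ≡⟨ cong (λ z → M₁ z ∘ ξ) pb₂-β ⟩
        M₁ (r ∘ x) ∘ ξ                               ≡⟨ sym M-fuse ⟩
        M₁ r ∘ (M₁ x ∘ ξ)                            ≡⟨ cong (M₁ r ∘_) (canonical-level K) ⟩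
        M₁ r ∘ constPath (M₁ ! ∘ ξ) (t ∘ (r ∘ c))    ≡⟨ constPath-map r _ _ ⟩
        constPath (M₁ ! ∘ ξ) (r ∘ (t ∘ (r ∘ c)))     ≡⟨ cong (λ z → constPath (M₁ ! ∘ ξ) (r ∘ z)) t-r-c ⟩
        lift₂ (r ∘ c) ξ ∎

    lift-identity : ∀ {V} (c : Hom V Γ) (ξ : Hom V (M X))
                    (K : IsConstOver x ξ (t ∘ (r ∘ c))) → lift (r ∘ c) ξ K ≡ ξ
    lift-identity c ξ K = begin
      M₁ p ∘ liftPath (r ∘ c) ξ K   ≡⟨ cong (M₁ p ∘_) (sym (liftPath-identity c ξ K)) ⟩
      M₁ p ∘ (M₁ (λ' x) ∘ ξ)        ≡⟨ M-fuse ⟩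
      M₁ (p ∘ λ' x) ∘ ξ             ≡⟨ cong (λ z → M₁ z ∘ ξ) p-λ ⟩
      M₁ id ∘ ξ                     ≡⟨ trans (cong (_∘ ξ) F-id) identityˡ ⟩
      ξ ∎

    isHomotopyLift : IsHomotopyLift R lift
    isHomotopyLift = record
      { lift-homotopy = λ ψ ξ K → lift-end s s-nat s-strong ψ ξ K (const-src K)
                                , lift-end t t-nat t-strong ψ ξ K (const-tgt K)
      ; lift-const    = lift-const
      ; lift-natural  = lift-natural
      ; lift-identity = lift-identity
      }

lemma6p9 : ∀ {o ℓ} (E : PathObjectCategory o ℓ) →
    let open PathOps E in
    ∀ {X Γ : Obj} (x : Hom X Γ) (R : RMap x) →
    Σ[ F ∈ LiftOp x ] IsHomotopyLift R F
lemma6p9 E x R = lift , isHomotopyLift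
  where open HomotopyLifting.Lift E x R
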